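{- Let $S$ be a connected colorful graph, let $e^*\in E(S)$, and let $S'$ be a proper subgraph of $S$. Then $\Gamma(S,\chi_{e^*})\otimes S'\simeq\Gamma(S,\chi_{\emptyset})\otimes S'$ (color-preserving isomorphism).
   Context: Graphs are vertex-colored; $S$ is colorful with color set $V(S)$ and identity coloring, and $S'$ is regarded as a graph on the same color set $V(S)$ with inherited colors. For $v\in V(S)$ let $I(v)$ be the set of edges of $S$ incident with $v$, and $A_v$ the set of even assignments in $\{0,1\}^{I(v)}$. For $c\in\{0,1\}^{E(S)}$, $\Gamma(S,c)$ is the colored graph whose vertices of color $v$ are the elements of $A_v$, and for each edge $uv\in E(S)$, $a_u\in A_u$ and $a_v\in A_v$ are adjacent iff $a_u(uv)\equiv a_v(uv)+c(uv)\pmod 2$; no other edges. $\chi_F\in\{0,1\}^{E(S)}$ is the indicator of $F\subseteq E(S)$, $\chi_e=\chi_{\{e\}}$. For colored graphs $G,X$ on color set $C$, the tensor product $G\otimes X$ has, for each color $i$, vertex set $V_i(G)\times V_i(X)$ (where $V_i$ denotes the $i$-colored vertices), and $(u_G,u_X)(v_G,v_X)$ is an edge iff $u_Gv_G\in E(G)$ and $u_Xv_X\in E(X)$. -}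

module Defs where

open import Data.Nat using (ℕ; zero; suc)
open import Data.Bool using (Bool; true; false; not; _∧_; _∨_; _xor_; T)
open import Data.Fin using (Fin; _≟_)
open import Data.Fin.Subset using (Subset; ∣_∣)
open import Data.Vec using (lookup)
open import Data.Fin using (zero; suc)
open import Data.Product using (Σ; _×_; _,_)
open import Relation.Nullary using (¬_)
open import Relation.Nullary.Decidable using (⌊_⌋)
open import Relation.Binary.PropositionalEquality using (_≡_)
open import Relation.Binary.Construct.Closure.ReflexiveTransitive using (Star)
open import Function.Bundles using (_↔_; _⇔_; Inverse)

-- A simple graph on vertex set Fin n (for a colorful graph S, the vertices
-- are the colors and the coloring is the identity).
record SimpleGraph (n : ℕ) : Set where
  field
    adj    : Fin n → Fin n → Bool
    sym    : ∀ u v → adj u v ≡ adj v u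
    irrefl : ∀ v → adj v v ≡ false
open SimpleGraph public

Connected : {n : ℕ} → SimpleGraph n → Set
Connected S = ∀ u v → Star (λ x y → adj S x y ≡ true) u v

record Subgraph {n : ℕ} (S : SimpleGraph n) : Set where
  field
    inV     : Fin n → Bool
    adj'    : Fin n → Fin n → Bool
    sym'    : ∀ u v → adj' u v ≡ adj' v u
    sub     : ∀ u v → adj' u v ≡ true → adj S u v ≡ true
    ends    : ∀ u v → adj' u v ≡ true → inV u ≡ true × inV v ≡ true
open Subgraph public

Proper : {n : ℕ} {S : SimpleGraph n} → Subgraph S → Set
Proper {S = S} S' = ¬ ((∀ v → inV S' v ≡ true) × (∀ u v → adj' S' u v ≡ adj S u v))

-- Colored graphs on the color set Fin n: V i is the set of vertices of color i.
record ColoredGraph (n : ℕ) : Set₁ where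
  field
    V : Fin n → Set
    E : {i j : Fin n} → V i → V j → Set
open ColoredGraph public

record _≃ᶜ_ {n : ℕ} (G H : ColoredGraph n) : Set where
  field
    iso  : (i : Fin n) → V G i ↔ V H i
    pres : ∀ {i j} (x : V G i) (y : V G j) →
           E G x y ⇔ E H (Inverse.to (iso i) x) (Inverse.to (iso j) y)

_⊗_ : {n : ℕ} → ColoredGraph n → ColoredGraph n → ColoredGraph n
G ⊗ X = record
  { V = λ i → V G i × V X i
  ; E = λ { (x , x') (y , y') → E G x y × E X x' y' } }

allFinB : (n : ℕ) → (Fin n → Bool) → Bool
allFinB zero f = true
allFinB (suc n) f = f zero ∧ allFinB n (λ i → f (suc i))

evenB : ℕ → Bool
evenB zero = true
evenB (suc k) = not (evenB k)

-- An assignment in {0,1}^{I(v)} is encoded as the subset a of Fin n of those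
-- w with vw ∈ E(S) and a(vw) = 1 (so a ⊆ N(v)). It is even iff |a| is even.
EvenAssign : {n : ℕ} → SimpleGraph n → Fin n → Subset n → Bool
EvenAssign {n} S v a = allFinB n (λ w → not (lookup a w) ∨ adj S v w) ∧ evenB ∣ a ∣

-- Edge labellings c ∈ {0,1}^{E(S)} are encoded as symmetric functions
-- c u v (only the values on edges of S matter).
Γ : {n : ℕ} → SimpleGraph n → (Fin n → Fin n → Bool) → ColoredGraph n
Γ {n} S c = record
  { V = λ v → Σ (Subset n) (λ a → T (EvenAssign S v a))
  ; E = λ { {u} {v} (a , _) (b , _) →
            adj S u v ≡ true × lookup a v ≡ (lookup b u xor c u v) } }

χ∅ : {n : ℕ} → Fin n → Fin n → Bool
χ∅ _ _ = false

χ₁ : {n : ℕ} → Fin n → Fin n → Fin n → Fin n → Bool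
χ₁ p q u v = (⌊ u ≟ p ⌋ ∧ ⌊ v ≟ q ⌋) ∨ (⌊ u ≟ q ⌋ ∧ ⌊ v ≟ p ⌋)

asColored : {n : ℕ} {S : SimpleGraph n} → Subgraph S → ColoredGraph n
asColored S' = record
  { V = λ i → T (inV S' i)
  ; E = λ {i} {j} _ _ → adj' S' i j ≡ true }

-- Γ(S, c) only depends on c up to coboundaries: adding a fixed even assignment t_v
-- to every vertex of color v is an isomorphism Γ(S, c) ≅ Γ(S, c + δt), where
-- (δt)(uv) = t_u(uv) + t_v(uv).  Choosing t supported at a single vertex w with
-- t_w = χ_uw + χ_ww' moves the label χ_uw to χ_ww', so in a connected S the edge e*
-- can be moved to any edge xy.  Since S' is proper, some edge xy of S is missing from
-- S' (if S' misses a vertex, take an edge at that vertex), and the tensor product with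
-- S' never reads the label of xy: there χ_xy is as good as χ_∅.

module Submission where

open import Defs hiding (sym)
open import Data.Nat using (ℕ; zero; suc)
open import Data.Bool using (Bool; true; false; not; _∧_; _∨_; _xor_; T) renaming (_≟_ to _≟ᵇ_)
open import Data.Bool.Properties
  using ( T-∧; T-≡; T-irrelevant; ¬-not; ∨-identityʳ; xor-identityʳ
        ; xor-annihilates-not; not-distribˡ-xor; not-distribʳ-xor )
open import Data.Bool.Solver using (module xor-∧-Solver)
open import Data.Fin using (Fin; zero; suc; _≟_)
open import Data.Fin.Properties using (all?; ¬∀⟶∃¬)
open import Data.Fin.Subset using (Subset; ∣_∣; ⊥; ⁅_⁆)
open import Data.Fin.Subset.Properties using (∣⊥∣≡0; ∣⁅x⁆∣≡1)
open import Data.Vec using ([]; _∷_; lookup; zipWith)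
open import Data.Vec.Properties using (lookup-zipWith; lookup-replicate)
open import Data.Product using (Σ; ∃; ∃₂; _×_; _,_; proj₁; proj₂)
open import Data.Product.Function.NonDependent.Propositional using (_×-↔_; _×-⇔_)
open import Data.Sum using (_⊎_; inj₁; inj₂)
open import Data.Unit using (tt)
open import Data.Empty using (⊥-elim)
open import Function using (_∘_)
open import Function.Bundles using (_⇔_; Equivalence; mk↔ₛ′; mk⇔)
open import Function.Construct.Composition using (_↔-∘_; _⇔-∘_)
open import Function.Construct.Identity using (↔-id; ⇔-id)
open import Relation.Binary.Construct.Closure.ReflexiveTransitive using (Star; ε; _◅_)
open import Relation.Nullary using (¬_; yes; no)
open import Relation.Nullary.Decidable using (⌊_⌋; toWitness)
open import Relation.Binary.PropositionalEquality

private
  variable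
    n : ℕ

xor-involutiveʳ : ∀ x s → (x xor s) xor s ≡ x
xor-involutiveʳ = solve 2 (λ x s → (x :+ s) :+ s := x) refl
  where open xor-∧-Solver

xor-cancelʳ : ∀ s {x y} → x xor s ≡ y xor s → x ≡ y
xor-cancelʳ s {x} {y} h = begin
  x               ≡⟨ sym (xor-involutiveʳ x s) ⟩
  (x xor s) xor s ≡⟨ cong (_xor s) h ⟩
  (y xor s) xor s ≡⟨ xor-involutiveʳ y s ⟩
  y               ∎
  where open ≡-Reasoning

T-not-xor : ∀ {x y} → T x → T y → T (not (x xor y))
T-not-xor {true} {true} _ _ = tt

T-xor : ∀ x {y} → T (x xor y) → T x ⊎ T y
T-xor true  _ = inj₁ tt
T-xor false h = inj₂ h

T-not-∨ : ∀ x {y} → T (not x ∨ y) ⇔ (T x → T y)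
T-not-∨ true  = mk⇔ (λ h _ → h) (λ f → f tt)
T-not-∨ false = mk⇔ (λ _ ()) (λ _ → tt)

T-allFinB : ∀ n {f : Fin n → Bool} → T (allFinB n f) ⇔ (∀ i → T (f i))
T-allFinB zero    = mk⇔ (λ _ ()) (λ _ → tt)
T-allFinB (suc n) {f} = mk⇔ to from
  where
  to : T (allFinB (suc n) f) → ∀ i → T (f i)
  to h zero    = proj₁ (Equivalence.to T-∧ h)
  to h (suc i) = Equivalence.to (T-allFinB n) (proj₂ (Equivalence.to T-∧ h)) i
  from : (∀ i → T (f i)) → T (allFinB (suc n) f)
  from g = Equivalence.from T-∧ (g zero , Equivalence.from (T-allFinB n) (g ∘ suc))

_⊕_ : Subset n → Subset n → Subset n
p ⊕ q = zipWith _xor_ p q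

lookup-⊕ : (p q : Subset n) (i : Fin n) → lookup (p ⊕ q) i ≡ lookup p i xor lookup q i
lookup-⊕ p q i = lookup-zipWith _xor_ i p q

evenB-∣⊕∣ : (p q : Subset n) → evenB ∣ p ⊕ q ∣ ≡ not (evenB ∣ p ∣ xor evenB ∣ q ∣)
evenB-∣⊕∣ []          []          = refl
evenB-∣⊕∣ (false ∷ p) (false ∷ q) = evenB-∣⊕∣ p q
evenB-∣⊕∣ (false ∷ p) (true ∷ q)  =
  cong not (trans (evenB-∣⊕∣ p q) (not-distribʳ-xor (evenB ∣ p ∣) (evenB ∣ q ∣)))
evenB-∣⊕∣ (true ∷ p)  (false ∷ q) =
  cong not (trans (evenB-∣⊕∣ p q) (not-distribˡ-xor (evenB ∣ p ∣) (evenB ∣ q ∣)))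
evenB-∣⊕∣ (true ∷ p)  (true ∷ q)  =
  trans (evenB-∣⊕∣ p q) (cong not (sym (xor-annihilates-not (evenB ∣ p ∣) (evenB ∣ q ∣))))

⊕-involutiveʳ : (p q : Subset n) → (p ⊕ q) ⊕ q ≡ p
⊕-involutiveʳ []      []      = refl
⊕-involutiveʳ (x ∷ p) (y ∷ q) = cong₂ _∷_ (xor-involutiveʳ x y) (⊕-involutiveʳ p q)

lookup-⁅⁆ : (u i : Fin n) → lookup ⁅ u ⁆ i ≡ ⌊ i ≟ u ⌋
lookup-⁅⁆ zero    zero    = refl
lookup-⁅⁆ zero    (suc i) = lookup-replicate i false
lookup-⁅⁆ (suc u) zero    = refl
lookup-⁅⁆ (suc u) (suc i) with i ≟ u | lookup-⁅⁆ u i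
... | yes _ | h = h
... | no _  | h = h

T-Σ-≡ : {A : Set} {P : A → Bool} {x y : Σ A (T ∘ P)} → proj₁ x ≡ proj₁ y → x ≡ y
T-Σ-≡ {x = a , pa} {y = .a , pb} refl = cong (a ,_) (T-irrelevant pa pb)

record IsEven (S : SimpleGraph n) (v : Fin n) (a : Subset n) : Set where
  constructor isEven
  field
    support : ∀ w → T (lookup a w) → T (adj S v w)
    parity  : T (evenB ∣ a ∣)

T-EvenAssign : {S : SimpleGraph n} {v : Fin n} {a : Subset n} → T (EvenAssign S v a) ⇔ IsEven S v a
T-EvenAssign {n} {S} {v} {a} = mk⇔ to from
  where
  to : T (EvenAssign S v a) → IsEven S v a
  to h = let support , parity = Equivalence.to T-∧ h in
    isEven (λ w → Equivalence.to (T-not-∨ (lookup a w)) (Equivalence.to (T-allFinB n) support w)) parity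
  from : IsEven S v a → T (EvenAssign S v a)
  from (isEven support parity) = Equivalence.from T-∧
    (Equivalence.from (T-allFinB n) (λ w → Equivalence.from (T-not-∨ (lookup a w)) (support w)) , parity)

⊕-isEven : {S : SimpleGraph n} {v : Fin n} {a b : Subset n} →
           IsEven S v a → IsEven S v b → IsEven S v (a ⊕ b)
⊕-isEven {S = S} {v} {a} {b} (isEven a-support a-parity) (isEven b-support b-parity) = isEven support parity
  where
  support : ∀ w → T (lookup (a ⊕ b) w) → T (adj S v w)
  support w h with T-xor (lookup a w) (subst T (lookup-⊕ a b w) h)
  ... | inj₁ a∋w = a-support w a∋w
  ... | inj₂ b∋w = b-support w b∋w
  parity : T (evenB ∣ a ⊕ b ∣)
  parity = subst T (sym (evenB-∣⊕∣ a b)) (T-not-xor a-parity b-parity)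

Assignments : SimpleGraph n → Fin n → Set
Assignments {n} S v = Σ (Subset n) (λ a → T (EvenAssign S v a))

≃ᶜ-trans : {G H K : ColoredGraph n} → G ≃ᶜ H → H ≃ᶜ K → G ≃ᶜ K
≃ᶜ-trans G≃H H≃K = record
  { iso  = λ i → _≃ᶜ_.iso H≃K i ↔-∘ _≃ᶜ_.iso G≃H i
  ; pres = λ x y → _≃ᶜ_.pres H≃K _ _ ⇔-∘ _≃ᶜ_.pres G≃H x y }

⊗-congˡ : {G H X : ColoredGraph n} → G ≃ᶜ H → (G ⊗ X) ≃ᶜ (H ⊗ X)
⊗-congˡ G≃H = record
  { iso  = λ i → _≃ᶜ_.iso G≃H i ×-↔ ↔-id _
  ; pres = λ (x , x′) (y , y′) → _≃ᶜ_.pres G≃H x y ×-⇔ ⇔-id _ }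

module _ (S : SimpleGraph n) (t : Fin n → Subset n) (t-even : ∀ v → IsEven S v (t v)) where

  switch : (v : Fin n) → Assignments S v → Assignments S v
  switch v (a , a-even) =
    a ⊕ t v , Equivalence.from T-EvenAssign
                (⊕-isEven (Equivalence.to (T-EvenAssign {S = S} {v} {a}) a-even) (t-even v))

  switch-involutive : ∀ v x → switch v (switch v x) ≡ x
  switch-involutive v (a , _) = T-Σ-≡ (⊕-involutiveʳ a (t v))

  Γ-switch : {c c′ : Fin n → Fin n → Bool} →
             (∀ u v → c′ u v ≡ c u v xor (lookup (t u) v xor lookup (t v) u)) →
             Γ S c ≃ᶜ Γ S c′
  Γ-switch {c} {c′} c′≡c+δt = record
    { iso  = λ v → mk↔ₛ′ (switch v) (switch v) (switch-involutive v) (switch-involutive v)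
    ; pres = λ x y → ⇔-id _ ×-⇔ label-switch x y }
    where
    label-switch : ∀ {u v} ((a , _) : Assignments S u) ((b , _) : Assignments S v) →
                   (lookup a v ≡ lookup b u xor c u v) ⇔
                   (lookup (a ⊕ t u) v ≡ lookup (b ⊕ t v) u xor c′ u v)
    label-switch {u} {v} (a , _) (b , _) =
      mk⇔ (λ h → trans lhs (trans (cong (_xor s) h) (sym rhs)))
          (λ h → xor-cancelʳ s (trans (sym lhs) (trans h rhs)))
      where
      open ≡-Reasoning
      open xor-∧-Solver
      s s′ : Bool
      s  = lookup (t u) v
      s′ = lookup (t v) u
      lhs : lookup (a ⊕ t u) v ≡ lookup a v xor s
      lhs = lookup-⊕ a (t u) v
      rhs : lookup (b ⊕ t v) u xor c′ u v ≡ (lookup b u xor c u v) xor s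
      rhs = begin
        lookup (b ⊕ t v) u xor c′ u v
          ≡⟨ cong₂ _xor_ (lookup-⊕ b (t v) u) (c′≡c+δt u v) ⟩
        (lookup b u xor s′) xor (c u v xor (s xor s′))
          ≡⟨ solve 4 (λ B C x x′ → (B :+ x′) :+ (C :+ (x :+ x′)) := (B :+ C) :+ x) refl
                     (lookup b u) (c u v) s s′ ⟩
        (lookup b u xor c u v) xor s
          ∎

toggleAt : Fin n → Subset n → Fin n → Subset n
toggleAt w s v with v ≟ w
... | yes _ = s
... | no _  = ⊥

lookup-toggleAt : (w : Fin n) (s : Subset n) (v i : Fin n) →
                  lookup (toggleAt w s v) i ≡ ⌊ v ≟ w ⌋ ∧ lookup s i
lookup-toggleAt w s v i with v ≟ w
... | yes _ = refl
... | no _  = lookup-replicate i false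

toggleAt-isEven : {S : SimpleGraph n} {w : Fin n} {s : Subset n} →
                  IsEven S w s → ∀ v → IsEven S v (toggleAt w s v)
toggleAt-isEven {n} {w = w} s-even v with v ≟ w
... | yes refl = s-even
... | no _     = isEven (λ i ∋i → ⊥-elim (subst T (lookup-replicate i false) ∋i))
                        (subst (T ∘ evenB) (sym (∣⊥∣≡0 n)) tt)

⁅⁆⊕⁅⁆-isEven : {S : SimpleGraph n} {w u u′ : Fin n} → adj S w u ≡ true → adj S w u′ ≡ true →
               IsEven S w (⁅ u ⁆ ⊕ ⁅ u′ ⁆)
⁅⁆⊕⁅⁆-isEven {S = S} {w} {u} {u′} wu wu′ = isEven support parity
  where
  adjacent-if-∈ : ∀ {i x} → adj S w x ≡ true → T (lookup ⁅ x ⁆ i) → T (adj S w i)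
  adjacent-if-∈ {i} {x} wx ∋i = subst (T ∘ adj S w) (sym (toWitness (subst T (lookup-⁅⁆ x i) ∋i)))
                                  (Equivalence.from T-≡ wx)
  support : ∀ i → T (lookup (⁅ u ⁆ ⊕ ⁅ u′ ⁆) i) → T (adj S w i)
  support i ∋i with T-xor (lookup ⁅ u ⁆ i) (subst T (lookup-⊕ ⁅ u ⁆ ⁅ u′ ⁆ i) ∋i)
  ... | inj₁ u∋i  = adjacent-if-∈ wu u∋i
  ... | inj₂ u′∋i = adjacent-if-∈ wu′ u′∋i
  parity : T (evenB ∣ ⁅ u ⁆ ⊕ ⁅ u′ ⁆ ∣)
  parity = subst T (sym (trans (evenB-∣⊕∣ ⁅ u ⁆ ⁅ u′ ⁆)
                               (cong₂ (λ k l → not (evenB k xor evenB l)) (∣⁅x⁆∣≡1 u) (∣⁅x⁆∣≡1 u′)))) tt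

adj⇒≢ : (S : SimpleGraph n) {a b : Fin n} → adj S a b ≡ true → a ≢ b
adj⇒≢ S {a} ab refl with trans (sym ab) (irrefl S a)
... | ()

adj-sym : (S : SimpleGraph n) {a b : Fin n} → adj S a b ≡ true → adj S b a ≡ true
adj-sym S {a} {b} ab = trans (SimpleGraph.sym S b a) ab

χ₁-as-xor : {p q : Fin n} → p ≢ q →
            ∀ a b → χ₁ p q a b ≡ (⌊ a ≟ p ⌋ ∧ ⌊ b ≟ q ⌋) xor (⌊ a ≟ q ⌋ ∧ ⌊ b ≟ p ⌋)
χ₁-as-xor {p = p} {q} p≢q a b with a ≟ p | a ≟ q
... | yes refl | yes refl = ⊥-elim (p≢q refl)
... | yes _    | no _     = trans (∨-identityʳ _) (sym (xor-identityʳ _))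
... | no _     | _        = refl

Γ-χ₁-step : (S : SimpleGraph n) {u w w′ : Fin n} → adj S u w ≡ true → adj S w w′ ≡ true →
            Γ S (χ₁ u w) ≃ᶜ Γ S (χ₁ w w′)
Γ-χ₁-step {n} S {u} {w} {w′} uw ww′ =
  Γ-switch S t (toggleAt-isEven (⁅⁆⊕⁅⁆-isEven (adj-sym S uw) ww′)) shift
  where
  t : Fin n → Subset n
  t = toggleAt w (⁅ u ⁆ ⊕ ⁅ w′ ⁆)
  lookup-t : ∀ a b → lookup (t a) b ≡ ⌊ a ≟ w ⌋ ∧ (⌊ b ≟ u ⌋ xor ⌊ b ≟ w′ ⌋)
  lookup-t a b = begin
    lookup (t a) b
      ≡⟨ lookup-toggleAt w _ a b ⟩
    ⌊ a ≟ w ⌋ ∧ lookup (⁅ u ⁆ ⊕ ⁅ w′ ⁆) b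
      ≡⟨ cong (⌊ a ≟ w ⌋ ∧_) (lookup-⊕ ⁅ u ⁆ ⁅ w′ ⁆ b) ⟩
    ⌊ a ≟ w ⌋ ∧ (lookup ⁅ u ⁆ b xor lookup ⁅ w′ ⁆ b)
      ≡⟨ cong (⌊ a ≟ w ⌋ ∧_) (cong₂ _xor_ (lookup-⁅⁆ u b) (lookup-⁅⁆ w′ b)) ⟩
    ⌊ a ≟ w ⌋ ∧ (⌊ b ≟ u ⌋ xor ⌊ b ≟ w′ ⌋)
      ∎
    where open ≡-Reasoning
  shift : ∀ a b → χ₁ w w′ a b ≡ χ₁ u w a b xor (lookup (t a) b xor lookup (t b) a)
  shift a b = begin
    χ₁ w w′ a b
      ≡⟨ χ₁-as-xor (adj⇒≢ S ww′) a b ⟩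
    (⌊ a ≟ w ⌋ ∧ ⌊ b ≟ w′ ⌋) xor (⌊ a ≟ w′ ⌋ ∧ ⌊ b ≟ w ⌋)
      ≡⟨ solve 6 (λ aw au aw′ bw bu bw′ → (aw :* bw′) :+ (aw′ :* bw) :=
                    ((au :* bw) :+ (aw :* bu)) :+ ((aw :* (bu :+ bw′)) :+ (bw :* (au :+ aw′)))) refl
                 ⌊ a ≟ w ⌋ ⌊ a ≟ u ⌋ ⌊ a ≟ w′ ⌋ ⌊ b ≟ w ⌋ ⌊ b ≟ u ⌋ ⌊ b ≟ w′ ⌋ ⟩
    ((⌊ a ≟ u ⌋ ∧ ⌊ b ≟ w ⌋) xor (⌊ a ≟ w ⌋ ∧ ⌊ b ≟ u ⌋))
      xor ((⌊ a ≟ w ⌋ ∧ (⌊ b ≟ u ⌋ xor ⌊ b ≟ w′ ⌋)) xor (⌊ b ≟ w ⌋ ∧ (⌊ a ≟ u ⌋ xor ⌊ a ≟ w′ ⌋)))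
      ≡⟨ sym (cong₂ _xor_ (χ₁-as-xor (adj⇒≢ S uw) a b) (cong₂ _xor_ (lookup-t a b) (lookup-t b a))) ⟩
    χ₁ u w a b xor (lookup (t a) b xor lookup (t b) a)
      ∎
    where
    open ≡-Reasoning
    open xor-∧-Solver

Γ-χ₁-walk : (S : SimpleGraph n) {u w x y : Fin n} → adj S u w ≡ true →
            Star (λ a b → adj S a b ≡ true) w x → adj S x y ≡ true →
            Γ S (χ₁ u w) ≃ᶜ Γ S (χ₁ x y)
Γ-χ₁-walk S uw ε          xy = Γ-χ₁-step S uw xy
Γ-χ₁-walk S uw (ww′ ◅ w′⇝x) xy = ≃ᶜ-trans (Γ-χ₁-step S uw ww′) (Γ-χ₁-walk S ww′ w′⇝x xy)

Γ-⊗-cong : {S : SimpleGraph n} (S' : Subgraph S) {c c′ : Fin n → Fin n → Bool} →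
           (∀ u v → adj' S' u v ≡ true → c u v ≡ c′ u v) →
           (Γ S c ⊗ asColored S') ≃ᶜ (Γ S c′ ⊗ asColored S')
Γ-⊗-cong S' c≡c′ = record
  { iso  = λ i → ↔-id _
  ; pres = λ {u} {v} _ ((b , _) , _) → mk⇔
      (λ ((uv , label) , uv∈S') → (uv , trans label (cong (lookup b u xor_) (c≡c′ u v uv∈S'))) , uv∈S')
      (λ ((uv , label) , uv∈S') → (uv , trans label (cong (lookup b u xor_) (sym (c≡c′ u v uv∈S')))) , uv∈S') }

≟-∧-mismatch : {a x b y : Fin n} → ¬ (a ≡ x × b ≡ y) → ⌊ a ≟ x ⌋ ∧ ⌊ b ≟ y ⌋ ≡ false
≟-∧-mismatch {a = a} {x} {b} {y} mismatch with a ≟ x | b ≟ y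
... | yes refl | yes refl = ⊥-elim (mismatch (refl , refl))
... | yes _    | no _     = refl
... | no _     | _        = refl

χ₁-off-subgraph : {S : SimpleGraph n} (S' : Subgraph S) {x y : Fin n} → adj' S' x y ≡ false →
                  ∀ a b → adj' S' a b ≡ true → χ₁ x y a b ≡ false
χ₁-off-subgraph S' {x} {y} xy∉S' a b ab∈S' =
  cong₂ _∨_ (≟-∧-mismatch {a = a} {x} {b} {y} λ { (refl , refl) → clash ab∈S' })
            (≟-∧-mismatch {a = a} {y} {b} {x} λ { (refl , refl) → clash (trans (sym' S' x y) ab∈S') })
  where
  clash : ¬ adj' S' x y ≡ true
  clash xy∈S' with trans (sym xy∈S') xy∉S'
  ... | ()

neighbour : {S : SimpleGraph n} → Connected S → {p q : Fin n} → adj S p q ≡ true →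
            ∀ v → ∃ λ w → adj S v w ≡ true
neighbour conn {p} pq v with conn v p
... | ε      = _ , pq
... | vw ◅ _ = _ , vw

subgraph-mismatch : {S : SimpleGraph n} (S' : Subgraph S) {u v : Fin n} → adj' S' u v ≢ adj S u v →
                    adj S u v ≡ true × adj' S' u v ≡ false
subgraph-mismatch S' {u} {v} differ with adj' S' u v in uv∈?S'
... | true  = ⊥-elim (differ (sym (sub S' u v uv∈?S')))
... | false = ¬-not (differ ∘ sym) , refl

missing-edge : {S : SimpleGraph n} → Connected S → {p q : Fin n} → adj S p q ≡ true →
               (S' : Subgraph S) → Proper S' → ∃₂ λ x y → adj S x y ≡ true × adj' S' x y ≡ false
missing-edge {n} {S} conn pq S' proper
  with all? (λ v → inV S' v ≟ᵇ true)
... | no some-vertex-missing =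
  let v , v∉S' = ¬∀⟶∃¬ n _ (λ v → inV S' v ≟ᵇ true) some-vertex-missing
      w , vw   = neighbour {S = S} conn pq v
  in v , w , vw , ¬-not (v∉S' ∘ proj₁ ∘ ends S' v w)
... | yes all-vertices
  with all? (λ u → all? (λ v → adj' S' u v ≟ᵇ adj S u v))
...   | yes all-edges = ⊥-elim (proper (all-vertices , all-edges))
...   | no some-edge-differs =
  let u , ¬row = ¬∀⟶∃¬ n _ (λ u → all? (λ v → adj' S' u v ≟ᵇ adj S u v)) some-edge-differs
      v , differ = ¬∀⟶∃¬ n _ (λ v → adj' S' u v ≟ᵇ adj S u v) ¬row
  in u , v , subgraph-mismatch S' differ

corollary3p5 : {n : ℕ} (S : SimpleGraph n) → Connected S →
               (p q : Fin n) → adj S p q ≡ true →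
               (S' : Subgraph S) → Proper S' →
               (Γ S (χ₁ p q) ⊗ asColored S') ≃ᶜ (Γ S χ∅ ⊗ asColored S')
corollary3p5 S conn p q pq S' proper =
  let x , y , xy , xy∉S' = missing-edge conn pq S' proper in
  ≃ᶜ-trans (⊗-congˡ (Γ-χ₁-walk S pq (conn q x) xy))
           (Γ-⊗-cong S' (χ₁-off-subgraph S' xy∉S'))
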